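{- Let $B$ be a connected graph of maximum degree at most four, and let $Y\subseteq V(B)$. Then there exist at least $(|Y|-1)/4$ pairwise vertex-disjoint paths in $B$, each with at least one edge and with both ends in $Y$.
   Context: Graphs are finite and may have loops and parallel edges. -}

module Defs where

open import Data.Nat using (ℕ; _+_; _*_; _≤_)
open import Data.Fin using (Fin; _≟_)
open import Data.Fin.Subset using (Subset; _∈_; ∣_∣)
open import Data.Product using (_×_; _,_; proj₁; proj₂; ∃)
open import Data.Sum using (_⊎_)
open import Data.List using (List; []; _∷_; _++_; [_]; length; filter; allFin)
open import Data.List.Relation.Unary.Linked using (Linked)
open import Data.List.Relation.Unary.Unique.Propositional using (Unique)
import Data.List.Membership.Propositional as LM
open import Relation.Binary.PropositionalEquality using (_≡_; _≢_)
open import Relation.Nullary using (¬_)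

-- A finite multigraph (loops and parallel edges allowed):
-- vertices Fin nV, edges Fin nE, each edge has two (possibly equal) ends.
record Graph : Set where
  field
    nV   : ℕ
    nE   : ℕ
    ends : Fin nE → Fin nV × Fin nV
open Graph public

-- Degree: number of edge-ends at v (a loop contributes 2).
degree : (G : Graph) → Fin (nV G) → ℕ
degree G v =
  length (filter (λ e → proj₁ (ends G e) ≟ v) (allFin (nE G)))
  + length (filter (λ e → proj₂ (ends G e) ≟ v) (allFin (nE G)))

MaxDegreeAtMost : Graph → ℕ → Set
MaxDegreeAtMost G d = ∀ v → degree G v ≤ d

Adj : (G : Graph) → Fin (nV G) → Fin (nV G) → Set
Adj G u v = ∃ λ e → (ends G e ≡ (u , v)) ⊎ (ends G e ≡ (v , u))

data Reach (G : Graph) : Fin (nV G) → Fin (nV G) → Set where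
  here : ∀ {u} → Reach G u u
  step : ∀ {u v w} → Adj G u v → Reach G v w → Reach G u w

Connected : Graph → Set
Connected G = ∀ u v → Reach G u v

record YPath (G : Graph) (Y : Subset (nV G)) : Set where
  field
    start  : Fin (nV G)
    mid    : List (Fin (nV G))
    finish : Fin (nV G)
    linked : Linked (Adj G) (start ∷ mid ++ [ finish ])
    unique : Unique (start ∷ mid ++ [ finish ])
    startY  : start ∈ Y
    finishY : finish ∈ Y

  verts : List (Fin (nV G))
  verts = start ∷ mid ++ [ finish ]
open YPath public

PairwiseDisjoint : {G : Graph} {Y : Subset (nV G)} {k : ℕ} → (Fin k → YPath G Y) → Set
PairwiseDisjoint {G} P = ∀ i j → i ≢ j → ∀ v → v LM.∈ verts (P i) → ¬ (v LM.∈ verts (P j))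

module Submission where

-- Grow a repetition-free tree of B rooted at some r that contains all of Y
-- (treeThrough) and work bottom-up. For the vertex list S of a subtree we build a
-- packing: disjoint Y-paths inside S, plus disjoint arms (paths from the subtree's
-- root to Y) avoiding them, with |Y ∩ S| ≤ 4·#paths + #arms (Balanced). At a vertex v
-- the arms coming from its children start at distinct neighbours of v, so there are
-- at most three of them, or four at the root. If v ∈ Y it starts an arm of its own,
-- otherwise it prolongs one child arm; if another child arm is left over, the two are
-- joined through v into a new path, which pays for the at most four discarded arms
-- (close). At the root at most one arm survives, so |Y| ≤ 4k + 1.

open import Defs
open import Data.Nat using (ℕ; _+_; _*_; _≤_)
open import Data.Fin using (Fin)
open import Data.Fin.Subset using (Subset; ∣_∣)
open import Data.Product using (Σ; _×_)

open import Data.Nat using (suc; _⊔_; z≤n; s≤s)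
open import Data.Nat.Properties
  using (≤-refl; ≤-trans; ≤-pred; ≤-reflexive; +-suc; +-monoʳ-≤; +-mono-≤; m≤m⊔n; ⊔-lub; ⊔-identityʳ; n≤1+n;
         module ≤-Reasoning)
open import Data.Nat.Tactic.RingSolver using (solve-∀)
open import Data.Fin using (_≟_)
open import Data.Fin.Subset using (inside; outside) renaming (_∈_ to _∈ˢ_)
open import Data.Fin.Subset.Properties using () renaming (_∈?_ to _∈ˢ?_)
import Data.Fin.Properties as Finₚ
open import Data.Product using (_,_; proj₁; proj₂; ∃)
open import Data.Sum using (_⊎_; inj₁; inj₂; [_,_]′)
open import Data.Empty using (⊥-elim)
open import Data.List using (List; []; _∷_; _++_; [_]; length; map; filter; lookup; allFin; _ʳ++_)
open import Data.List.Properties using (length-++; length-map; filter-++; filter-accept; filter-reject; ʳ++-defn)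
open import Data.List.Membership.Propositional using (_∈_; _∉_)
open import Data.List.Membership.Propositional.Properties
  using (∈-++⁻; ∈-++⁺ˡ; ∈-++⁺ʳ; ∈-∃++; ∈-map⁺; ∈-map⁻; ∈-filter⁺; ∈-lookup; ∈-allFin)
open import Data.List.Relation.Binary.Subset.Propositional using (_⊆_)
open import Data.List.Relation.Binary.Subset.Propositional.Properties using (⊆-trans; xs⊆xs++ys; xs⊆ys++xs)
open import Data.List.Relation.Binary.Disjoint.Propositional using (Disjoint)
open import Data.List.Relation.Binary.Permutation.Propositional
  using (_↭_; ↭-refl; ↭-trans; ↭-sym; prep; swap; ↭⇒↭ₛ)
open import Data.List.Relation.Binary.Permutation.Propositional.Properties
  using (∈-resp-↭; ++⁺ˡ; ++⁺ʳ; shift; ↭-reverse; ↭-length)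
import Data.List.Relation.Binary.Permutation.Setoid.Properties as Permutationₛ
open import Data.List.Relation.Unary.Any using (here; there)
open import Data.List.Relation.Unary.All using (All; []; _∷_)
import Data.List.Relation.Unary.All as All
import Data.List.Relation.Unary.All.Properties as All
open import Data.List.Relation.Unary.AllPairs using (AllPairs; []; _∷_)
import Data.List.Relation.Unary.AllPairs as AllPairs
import Data.List.Relation.Unary.AllPairs.Properties as AllPairs
open import Data.List.Relation.Unary.Linked using (Linked; [-]; _∷_)
open import Data.List.Relation.Unary.Unique.Propositional using (Unique)
import Data.List.Relation.Unary.Unique.Propositional.Properties as Unique
open import Data.Vec using () renaming ([] to []ᵛ; _∷_ to _∷ᵛ_)
open import Data.Vec.Base using (here; there)
open import Function using (_∘_; id)
open import Relation.Binary.PropositionalEquality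
  using (_≡_; _≢_; refl; sym; trans; cong; cong₂; subst; setoid)
open import Relation.Nullary using (¬_; Dec; yes; no)

module _ {A : Set} where

  unique-∷ : ∀ {x : A} {xs} → x ∉ xs → Unique xs → Unique (x ∷ xs)
  unique-∷ {xs = xs} x∉xs u = All.¬Any⇒All¬ xs x∉xs ∷ u

  unique-↭ : ∀ {xs ys : List A} → xs ↭ ys → Unique xs → Unique ys
  unique-↭ p = Permutationₛ.Unique-resp-↭ (setoid A) (↭⇒↭ₛ p)

  unique-++⁻ : ∀ (xs : List A) {ys} → Unique (xs ++ ys) → Unique xs × Unique ys × Disjoint xs ys
  unique-++⁻ [] u = [] , u , λ ()
  unique-++⁻ (x ∷ xs) (x∉ ∷ u) with unique-++⁻ xs u
  ... | uxs , uys , disj =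
    unique-∷ (λ m → All.lookup x∉ (∈-++⁺ˡ m) refl) uxs , uys ,
    λ { (here refl , y∈) → All.lookup x∉ (∈-++⁺ʳ xs y∈) refl
      ; (there m , y∈) → disj (m , y∈) }

  disjoint-sym : ∀ {xs ys : List A} → Disjoint xs ys → Disjoint ys xs
  disjoint-sym d (y∈ , x∈) = d (x∈ , y∈)

  disjoint-∷ : ∀ {x : A} {xs ys} → x ∉ ys → Disjoint xs ys → Disjoint (x ∷ xs) ys
  disjoint-∷ x∉ d (here refl , m) = x∉ m
  disjoint-∷ x∉ d (there m , m′) = d (m , m′)

  disjoint-++ : ∀ {xs ys zs : List A} → Disjoint xs zs → Disjoint ys zs → Disjoint (xs ++ ys) zs
  disjoint-++ {xs} d d′ (m , m′) with ∈-++⁻ xs m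
  ... | inj₁ m∈xs = d (m∈xs , m′)
  ... | inj₂ m∈ys = d′ (m∈ys , m′)

  disjoint-⊆ : ∀ {xs ys as bs : List A} → Disjoint xs ys → as ⊆ xs → bs ⊆ ys → Disjoint as bs
  disjoint-⊆ d as⊆ bs⊆ (a , b) = d (as⊆ a , bs⊆ b)

  extract : ∀ {x : A} {ys} → x ∈ ys → ∃ λ zs → ys ↭ x ∷ zs
  extract {x} x∈ with as , bs , refl ← ∈-∃++ x∈ = as ++ bs , shift x as bs

  unique-length : ∀ {xs ys : List A} → Unique xs → xs ⊆ ys → length xs ≤ length ys
  unique-length {[]} _ _ = z≤n
  unique-length {x ∷ xs} {ys} (x∉ ∷ u) sub with zs , ys↭ ← extract (sub (here refl)) =
    subst (suc (length xs) ≤_) (sym (↭-length ys↭)) (s≤s (unique-length u xs⊆zs))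
    where
    xs⊆zs : xs ⊆ zs
    xs⊆zs y∈ with ∈-resp-↭ ys↭ (sub (there y∈))
    ... | here y≡x = ⊥-elim (All.lookup x∉ y∈ (sym y≡x))
    ... | there y∈zs = y∈zs

  allPairs-lookup : ∀ {R : A → A → Set} → (∀ {x y} → R x y → R y x) →
                    ∀ {xs} → AllPairs R xs → ∀ {i j} → i ≢ j → R (lookup xs i) (lookup xs j)
  allPairs-lookup R-sym (_ ∷ _) {Fin.zero} {Fin.zero} i≢j = ⊥-elim (i≢j refl)
  allPairs-lookup R-sym (r ∷ _) {Fin.zero} {Fin.suc j} _ = All.lookup r (∈-lookup j)
  allPairs-lookup R-sym (r ∷ _) {Fin.suc i} {Fin.zero} _ = R-sym (All.lookup r (∈-lookup i))
  allPairs-lookup R-sym (_ ∷ rs) {Fin.suc i} {Fin.suc j} i≢j =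
    allPairs-lookup R-sym rs (i≢j ∘ cong Fin.suc)

  lastOf : A → List A → A
  lastOf x [] = x
  lastOf x (y ∷ ys) = lastOf y ys

  snoc-view : ∀ (x : A) xs → ∃ λ init → x ∷ xs ≡ init ++ [ lastOf x xs ]
  snoc-view x [] = [] , refl
  snoc-view x (y ∷ ys) with init , eq ← snoc-view y ys = x ∷ init , cong (x ∷_) eq

  ʳ++-ends : ∀ (x : A) xs y ys → ∃ λ mid → (x ∷ xs) ʳ++ (y ∷ ys) ≡ lastOf x xs ∷ mid ++ [ lastOf y ys ]
  ʳ++-ends x [] y ys with init , eq ← snoc-view y ys = init , cong (x ∷_) eq
  ʳ++-ends x (x′ ∷ xs) y ys = ʳ++-ends x′ xs x (y ∷ ys)

  ʳ++-↭ : ∀ (xs : List A) {ys} → xs ʳ++ ys ↭ xs ++ ys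
  ʳ++-↭ xs {ys} = subst (_↭ xs ++ ys) (sym (ʳ++-defn xs)) (++⁺ʳ ys (↭-reverse xs))

  linked-ʳ++ : ∀ {R : A → A → Set} → (∀ {a b} → R a b → R b a) →
               ∀ {x} xs {ys} → Linked R (x ∷ xs) → Linked R (x ∷ ys) → Linked R (xs ʳ++ (x ∷ ys))
  linked-ʳ++ R-sym [] _ l = l
  linked-ʳ++ R-sym (_ ∷ xs) (r ∷ lx) ly = linked-ʳ++ R-sym xs lx (R-sym r ∷ ly)

members : ∀ {n} → Subset n → List (Fin n)
members []ᵛ = []
members (inside ∷ᵛ p) = Fin.zero ∷ map Fin.suc (members p)
members (outside ∷ᵛ p) = map Fin.suc (members p)

members-length : ∀ {n} (p : Subset n) → length (members p) ≡ ∣ p ∣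
members-length []ᵛ = refl
members-length (inside ∷ᵛ p) = cong suc (trans (length-map Fin.suc (members p)) (members-length p))
members-length (outside ∷ᵛ p) = trans (length-map Fin.suc (members p)) (members-length p)

members-sound : ∀ {n} (p : Subset n) {x} → x ∈ members p → x ∈ˢ p
members-sound (inside ∷ᵛ p) (here refl) = here
members-sound (inside ∷ᵛ p) (there x∈) with _ , y∈ , refl ← ∈-map⁻ Fin.suc x∈ = there (members-sound p y∈)
members-sound (outside ∷ᵛ p) x∈ with _ , y∈ , refl ← ∈-map⁻ Fin.suc x∈ = there (members-sound p y∈)

members-unique : ∀ {n} (p : Subset n) → Unique (members p)
members-unique []ᵛ = []
members-unique (inside ∷ᵛ p) = unique-∷ zero∉ (Unique.map⁺ Finₚ.suc-injective (members-unique p))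
  where
  zero∉ : Fin.zero ∉ map Fin.suc (members p)
  zero∉ m with _ , _ , () ← ∈-map⁻ Fin.suc m
members-unique (outside ∷ᵛ p) = Unique.map⁺ Finₚ.suc-injective (members-unique p)

countIn : ∀ {n} → Subset n → List (Fin n) → ℕ
countIn p L = length (filter (_∈ˢ? p) L)

card-≤-countIn : ∀ {n} (p : Subset n) {L} → members p ⊆ L → ∣ p ∣ ≤ countIn p L
card-≤-countIn p {L} covers =
  subst (_≤ countIn p L) (members-length p)
    (unique-length (members-unique p) (λ m → ∈-filter⁺ (_∈ˢ? p) (covers m) (members-sound p m)))

countIn-++ : ∀ {n} (p : Subset n) xs {ys} → countIn p (xs ++ ys) ≡ countIn p xs + countIn p ys
countIn-++ p xs {ys} = trans (cong length (filter-++ (_∈ˢ? p) xs ys)) (length-++ (filter (_∈ˢ? p) xs))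

countIn-∈ : ∀ {n} (p : Subset n) {x} L → x ∈ˢ p → countIn p (x ∷ L) ≡ suc (countIn p L)
countIn-∈ p L x∈p = cong length (filter-accept (_∈ˢ? p) x∈p)

countIn-∉ : ∀ {n} (p : Subset n) {x} L → ¬ x ∈ˢ p → countIn p (x ∷ L) ≡ countIn p L
countIn-∉ p L x∉p = cong length (filter-reject (_∈ˢ? p) x∉p)

module _ (B : Graph) where

  private
    V = Fin (nV B)
  open import Data.List.Membership.DecPropositional (_≟_ {n = nV B}) using (_∈?_)

  adj-sym : ∀ {u v} → Adj B u v → Adj B v u
  adj-sym (e , inj₁ p) = e , inj₂ p
  adj-sym (e , inj₂ p) = e , inj₁ p

  -- An edge-end of B: inj₁ e is the first end of e, inj₂ e its second end.
  -- The ends at v are exactly what degree B v counts; each points to a far end.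
  EdgeEnd : Set
  EdgeEnd = Fin (nE B) ⊎ Fin (nE B)

  edgesWith : (V × V → V) → V → List (Fin (nE B))
  edgesWith end v = filter (λ e → end (ends B e) ≟ v) (allFin (nE B))

  edgesWith-∈ : ∀ end {v} e → end (ends B e) ≡ v → e ∈ edgesWith end v
  edgesWith-∈ end {v} e = ∈-filter⁺ (λ e → end (ends B e) ≟ v) (∈-allFin e)

  endsAt : V → List EdgeEnd
  endsAt v = map inj₁ (edgesWith proj₁ v) ++ map inj₂ (edgesWith proj₂ v)

  farEnd : EdgeEnd → V
  farEnd (inj₁ e) = proj₂ (ends B e)
  farEnd (inj₂ e) = proj₁ (ends B e)

  length-endsAt : ∀ v → length (endsAt v) ≡ degree B v
  length-endsAt v = trans (length-++ (map inj₁ (edgesWith proj₁ v)))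
    (cong₂ _+_ (length-map inj₁ (edgesWith proj₁ v)) (length-map inj₂ (edgesWith proj₂ v)))

  neighbour-farEnd : ∀ {v u} → Adj B v u → u ∈ map farEnd (endsAt v)
  neighbour-farEnd {v} (e , inj₁ p) = subst (_∈ map farEnd (endsAt v)) (cong proj₂ p)
    (∈-map⁺ farEnd (∈-++⁺ˡ (∈-map⁺ inj₁ (edgesWith-∈ proj₁ e (cong proj₁ p)))))
  neighbour-farEnd {v} (e , inj₂ p) = subst (_∈ map farEnd (endsAt v)) (cong proj₁ p)
    (∈-map⁺ farEnd (∈-++⁺ʳ (map inj₁ (edgesWith proj₁ v))
                           (∈-map⁺ inj₂ (edgesWith-∈ proj₂ e (cong proj₂ p)))))

  distinct-neighbours : ∀ {v us} → Unique us → All (Adj B v) us → length us ≤ degree B v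
  distinct-neighbours {v} u adj =
    ≤-trans (unique-length u (λ m → neighbour-farEnd (All.lookup adj m)))
      (≤-reflexive (trans (length-map farEnd (endsAt v)) (length-endsAt v)))

  -- A tree of B rooted at v, in first-child/next-sibling form: `branch e s t`
  -- hangs the subtree s, rooted at a neighbour c of v (via the edge e), below v,
  -- next to the remaining subtrees t of v.
  data Tree (v : V) : Set where
    leaf   : Tree v
    branch : ∀ {c} → Adj B v c → Tree c → Tree v → Tree v

  below : ∀ {v} → Tree v → List V
  below leaf = []
  below (branch {c} _ s t) = (c ∷ below s) ++ below t

  vertices : ∀ {v} → Tree v → List V
  vertices {v} t = v ∷ below t

  unique-branch : ∀ {v c} (e : Adj B v c) s t → Unique (vertices (branch e s t)) →
                  Unique (vertices s) × Unique (vertices t) × v ∉ vertices s × Disjoint (vertices s) (below t)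
  unique-branch {v} {c} _ s _ (v∉ ∷ u) with unique-++⁻ (c ∷ below s) u
  ... | us , ut , disj =
    us , unique-∷ (λ m → All.lookup v∉ (∈-++⁺ʳ (c ∷ below s) m) refl) ut ,
    (λ m → All.lookup v∉ (∈-++⁺ˡ m) refl) , disj

  graft : ∀ {v u w} → Adj B u w → Tree v → Tree v
  graft {v} {u} a t with u ≟ v
  ... | yes refl = branch a leaf t
  graft a leaf | no _ = leaf
  graft {u = u} a (branch {c} e s t) | no _ with u ∈? vertices s
  ... | yes _ = branch e (graft a s) t
  ... | no _ = branch e s (graft a t)

  graft-↭ : ∀ {v u w} (a : Adj B u w) (t : Tree v) → u ∈ vertices t → below (graft a t) ↭ w ∷ below t
  graft-↭ {v} {u} a t u∈ with u ≟ v
  ... | yes refl = ↭-refl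
  graft-↭ a leaf (here u≡v) | no u≢v = ⊥-elim (u≢v u≡v)
  graft-↭ {u = u} {w} a (branch {c} e s t) u∈ | no u≢v with u ∈? vertices s
  ... | yes u∈s = ↭-trans (++⁺ʳ (below t) (prep c (graft-↭ a s u∈s))) (swap c w ↭-refl)
  ... | no u∉s = ↭-trans (++⁺ˡ (c ∷ below s) (graft-↭ a t (u∈t u∈))) (shift w (c ∷ below s) (below t))
    where
    u∈t : u ∈ vertices (branch e s t) → u ∈ vertices t
    u∈t (here u≡v) = ⊥-elim (u≢v u≡v)
    u∈t (there m) with ∈-++⁻ (c ∷ below s) m
    ... | inj₁ m∈s = ⊥-elim (u∉s m∈s)
    ... | inj₂ m∈t = there m∈t

  record Enlargement {r} (t : Tree r) (x : V) : Set where
    field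
      tree     : Tree r
      distinct : Unique (vertices tree)
      grows    : vertices t ⊆ vertices tree
      reaches  : x ∈ vertices tree

  -- Following a walk from a vertex of the tree, graft each vertex not yet in the tree.
  enlarge : ∀ {r u x} (t : Tree r) → Unique (vertices t) → u ∈ vertices t → Reach B u x → Enlargement t x
  enlarge t uq u∈ here = record { tree = t ; distinct = uq ; grows = id ; reaches = u∈ }
  enlarge t uq u∈ (step {v = w} a walk) with w ∈? vertices t
  ... | yes w∈ = enlarge t uq w∈ walk
  ... | no w∉ = record { tree = tree ; distinct = distinct ; reaches = reaches
                       ; grows = grows ∘ ∈-resp-↭ (↭-sym grafted) ∘ there }
    where
    grafted : vertices (graft a t) ↭ w ∷ vertices t
    grafted = ↭-trans (prep _ (graft-↭ a t u∈)) (swap _ w ↭-refl)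
    open Enlargement (enlarge (graft a t) (unique-↭ (↭-sym grafted) (unique-∷ w∉ uq))
                              (∈-resp-↭ (↭-sym grafted) (here refl)) walk)

  treeThrough : Connected B → ∀ r xs → Σ (Tree r) λ t → Unique (vertices t) × xs ⊆ vertices t
  treeThrough conn r [] = leaf , [] ∷ [] , λ ()
  treeThrough conn r (x ∷ xs) with t , uq , covers ← treeThrough conn r xs =
    tree , distinct , λ { (here refl) → reaches ; (there m) → grows (covers m) }
    where open Enlargement (enlarge t uq (here refl) (conn r x))

module _ (B : Graph) (Y : Subset (nV B)) where

  private
    V = Fin (nV B)
    YP = YPath B Y

  -- An arm: a repetition-free path base, …, y whose last vertex y lies in Y
  -- (possibly the single vertex base ∈ Y). Arms are half-finished Y-paths.
  record Arm : Set where
    field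
      base     : V
      onward   : List V
      chain    : Linked (Adj B) (base ∷ onward)
      distinct : Unique (base ∷ onward)
      endsInY  : lastOf base onward ∈ˢ Y

    trail : List V
    trail = base ∷ onward
  open Arm

  singleArm : ∀ {v} → v ∈ˢ Y → Arm
  singleArm {v} v∈Y = record { base = v ; onward = [] ; chain = [-] ; distinct = [] ∷ [] ; endsInY = v∈Y }

  extendArm : ∀ {v} (a : Arm) → Adj B v (base a) → v ∉ trail a → Arm
  extendArm {v} a adj v∉a = record
    { base = v ; onward = trail a ; chain = adj ∷ chain a
    ; distinct = unique-∷ v∉a (distinct a) ; endsInY = endsInY a }

  -- Two disjoint arms with adjacent bases form a Y-path: walk the first arm backwards,
  -- cross the edge between the bases, and walk the second arm forwards.
  joinShape : (a b : Arm) → ∃ λ mid →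
    trail a ʳ++ trail b ≡ lastOf (base a) (onward a) ∷ mid ++ [ lastOf (base b) (onward b) ]
  joinShape a b = ʳ++-ends (base a) (onward a) (base b) (onward b)

  joinArms : (a b : Arm) → Adj B (base a) (base b) → Disjoint (trail a) (trail b) → YP
  joinArms a b adj disj = record
    { start   = lastOf (base a) (onward a)
    ; mid     = proj₁ (joinShape a b)
    ; finish  = lastOf (base b) (onward b)
    ; linked  = subst (Linked (Adj B)) (proj₂ (joinShape a b))
                  (linked-ʳ++ (adj-sym B) (onward a) (chain a) (adj ∷ chain b))
    ; unique  = subst Unique (proj₂ (joinShape a b))
                  (unique-↭ (↭-sym (ʳ++-↭ (trail a))) (Unique.++⁺ (distinct a) (distinct b) disj))
    ; startY  = endsInY a
    ; finishY = endsInY b }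

  joinArms-⊆ : ∀ a b (adj : Adj B (base a) (base b)) (disj : Disjoint (trail a) (trail b)) →
               verts (joinArms a b adj disj) ⊆ trail a ++ trail b
  joinArms-⊆ a b adj disj = ∈-resp-↭ (ʳ++-↭ (trail a)) ∘ subst (_ ∈_) (sym (proj₂ (joinShape a b)))

  record Valid (S : List V) (ps : List YP) (as : List Arm) : Set where
    field
      pathsDisjoint : AllPairs (λ P Q → Disjoint (verts P) (verts Q)) ps
      pathsInside   : All (λ P → verts P ⊆ S) ps
      armsDisjoint  : AllPairs (λ a b → Disjoint (trail a) (trail b)) as
      armsInside    : All (λ a → trail a ⊆ S) as
      armsAvoid     : All (λ a → All (λ P → Disjoint (trail a) (verts P)) ps) as
  open Valid

  valid-empty : ∀ {S} → Valid S [] []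
  valid-empty = record
    { pathsDisjoint = [] ; pathsInside = [] ; armsDisjoint = [] ; armsInside = [] ; armsAvoid = [] }

  inside-⊆ : ∀ {X : Set} {f : X → List V} {S S′ xs} → S ⊆ S′ →
             All (λ x → f x ⊆ S) xs → All (λ x → f x ⊆ S′) xs
  inside-⊆ S⊆ [] = []
  inside-⊆ S⊆ (x⊆ ∷ xs⊆) = ⊆-trans x⊆ S⊆ ∷ inside-⊆ S⊆ xs⊆

  valid-weaken : ∀ {S S′ ps as} → S ⊆ S′ → Valid S ps as → Valid S′ ps as
  valid-weaken S⊆ V = record
    { pathsDisjoint = pathsDisjoint V ; pathsInside = inside-⊆ S⊆ (pathsInside V)
    ; armsDisjoint = armsDisjoint V ; armsInside = inside-⊆ S⊆ (armsInside V) ; armsAvoid = armsAvoid V }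

  apart : ∀ {S₁ S₂ ys} {Z : Set} {g : Z → List V} {zs} → Disjoint S₁ S₂ →
          ys ⊆ S₁ → All (λ z → g z ⊆ S₂) zs → All (λ z → Disjoint ys (g z)) zs
  apart d ys⊆ [] = []
  apart d ys⊆ (z⊆ ∷ zs⊆) = disjoint-⊆ d ys⊆ z⊆ ∷ apart d ys⊆ zs⊆

  across : ∀ {S₁ S₂} {X Z : Set} {f : X → List V} {g : Z → List V} {xs zs} → Disjoint S₁ S₂ →
           All (λ x → f x ⊆ S₁) xs → All (λ z → g z ⊆ S₂) zs →
           All (λ x → All (λ z → Disjoint (f x) (g z)) zs) xs
  across d [] _ = []
  across d (x⊆ ∷ xs⊆) zs⊆ = apart d x⊆ zs⊆ ∷ across d xs⊆ zs⊆

  valid-++ : ∀ {S₁ S₂ ps₁ ps₂ as₁ as₂} → Disjoint S₁ S₂ →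
             Valid S₁ ps₁ as₁ → Valid S₂ ps₂ as₂ → Valid (S₁ ++ S₂) (ps₁ ++ ps₂) (as₁ ++ as₂)
  valid-++ {S₁} {S₂} d V W = record
    { pathsDisjoint = AllPairs.++⁺ (pathsDisjoint V) (pathsDisjoint W) (across d (pathsInside V) (pathsInside W))
    ; pathsInside   = All.++⁺ (inside-⊆ (xs⊆xs++ys S₁ S₂) (pathsInside V))
                              (inside-⊆ (xs⊆ys++xs S₂ S₁) (pathsInside W))
    ; armsDisjoint  = AllPairs.++⁺ (armsDisjoint V) (armsDisjoint W) (across d (armsInside V) (armsInside W))
    ; armsInside    = All.++⁺ (inside-⊆ (xs⊆xs++ys S₁ S₂) (armsInside V))
                              (inside-⊆ (xs⊆ys++xs S₂ S₁) (armsInside W))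
    ; armsAvoid     = All.++⁺
        (All.zipWith (λ (avoid , far) → All.++⁺ avoid far) (armsAvoid V , across d (armsInside V) (pathsInside W)))
        (All.zipWith (λ (far , avoid) → All.++⁺ far avoid)
          (across (disjoint-sym d) (armsInside W) (pathsInside V) , armsAvoid W)) }

  fresh : ∀ {X : Set} {f : X → List V} {v S xs} → v ∉ S →
          All (λ x → f x ⊆ S) xs → All (λ x → Disjoint [ v ] (f x)) xs
  fresh v∉ [] = []
  fresh v∉ (x⊆ ∷ xs⊆) = disjoint-∷ (v∉ ∘ x⊆) (λ { (() , _) }) ∷ fresh v∉ xs⊆

  prefix : ∀ {X : Set} {f : X → List V} {v S ys xs} → v ∉ S → All (λ x → f x ⊆ S) xs →
           All (λ x → Disjoint ys (f x)) xs → All (λ x → Disjoint (v ∷ ys) (f x)) xs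
  prefix v∉ [] [] = []
  prefix v∉ (x⊆ ∷ xs⊆) (d ∷ ds) = disjoint-∷ (v∉ ∘ x⊆) d ∷ prefix v∉ xs⊆ ds

  valid-single : ∀ {v S ps as} → v ∉ S → (v∈Y : v ∈ˢ Y) → Valid S ps as →
                 Valid (v ∷ S) ps (singleArm v∈Y ∷ as)
  valid-single v∉ v∈Y V = record
    { pathsDisjoint = pathsDisjoint V
    ; pathsInside   = inside-⊆ there (pathsInside V)
    ; armsDisjoint  = fresh v∉ (armsInside V) ∷ armsDisjoint V
    ; armsInside    = (λ { (here refl) → here refl }) ∷ inside-⊆ there (armsInside V)
    ; armsAvoid     = fresh v∉ (pathsInside V) ∷ armsAvoid V }

  valid-extend : ∀ {v S ps a as} → (v∉ : v ∉ S) (adj : Adj B v (base a)) (v∉a : v ∉ trail a) →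
                 Valid S ps (a ∷ as) → Valid (v ∷ S) ps (extendArm a adj v∉a ∷ as)
  valid-extend v∉ adj v∉a V
    with a⊆ ∷ as⊆ ← armsInside V | a-as ∷ as-as ← armsDisjoint V | a-ps ∷ as-ps ← armsAvoid V
    = record
    { pathsDisjoint = pathsDisjoint V
    ; pathsInside   = inside-⊆ there (pathsInside V)
    ; armsDisjoint  = prefix v∉ as⊆ a-as ∷ as-as
    ; armsInside    = (λ { (here refl) → here refl ; (there m) → there (a⊆ m) }) ∷ inside-⊆ there as⊆
    ; armsAvoid     = prefix v∉ (pathsInside V) a-ps ∷ as-ps }

  avoid-⊆ : ∀ {xs ys zs : List V} {ps : List YP} → zs ⊆ xs ++ ys → All (λ P → Disjoint xs (verts P)) ps →
            All (λ P → Disjoint ys (verts P)) ps → All (λ P → Disjoint zs (verts P)) ps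
  avoid-⊆ zs⊆ [] [] = []
  avoid-⊆ zs⊆ (d ∷ ds) (e ∷ es) = disjoint-⊆ (disjoint-++ d e) zs⊆ (λ m → m) ∷ avoid-⊆ zs⊆ ds es

  arms-apart : ∀ {S ps a b as} → Valid S ps (b ∷ a ∷ as) → Disjoint (trail a) (trail b)
  arms-apart V with (b-a ∷ _) ∷ _ ← armsDisjoint V = disjoint-sym b-a

  valid-join : ∀ {S ps a b as} (adj : Adj B (base a) (base b)) (V : Valid S ps (b ∷ a ∷ as)) →
               Valid S (joinArms a b adj (arms-apart V) ∷ ps) []
  valid-join {a = a} {b} adj V with b⊆ ∷ a⊆ ∷ _ ← armsInside V | b-ps ∷ a-ps ∷ _ ← armsAvoid V = record
    { pathsDisjoint = avoid-⊆ P⊆ a-ps b-ps ∷ pathsDisjoint V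
    ; pathsInside   = (λ m → [ a⊆ , b⊆ ]′ (∈-++⁻ (trail a) (P⊆ m))) ∷ pathsInside V
    ; armsDisjoint  = [] ; armsInside = [] ; armsAvoid = [] }
    where
    P⊆ : verts (joinArms a b adj (arms-apart V)) ⊆ trail a ++ trail b
    P⊆ = joinArms-⊆ a b adj (arms-apart V)

  record Packing (S : List V) (Good : V → Set) : Set where
    constructor packing
    field
      paths : List YP
      arms  : List Arm
      valid : Valid S paths arms
      good  : All (Good ∘ base) arms
  open Packing

  -- The counting invariant: each path pays for four vertices of Y in S, each arm for one.
  Balanced : ∀ {S G} → Packing S G → Set
  Balanced {S} P = countIn Y S ≤ 4 * length (paths P) + length (arms P)

  -- The same invariant with an allowance of `slack` extra vertices when there are few arms.
  Tally : ∀ {S G} → ℕ → Packing S G → Set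
  Tally {S} slack P = countIn Y S ≤ 4 * length (paths P) + (length (arms P) ⊔ slack)

  merge : ∀ {S₁ S₂ G} → Disjoint S₁ S₂ →
          (P : Packing S₁ G) → Balanced P → (Q : Packing S₂ G) → Balanced Q →
          Σ (Packing (S₁ ++ S₂) G) Balanced
  merge {S₁} {S₂} d (packing ps₁ as₁ V₁ g₁) c₁ (packing ps₂ as₂ V₂ g₂) c₂ =
    packing (ps₁ ++ ps₂) (as₁ ++ as₂) (valid-++ d V₁ V₂) (All.++⁺ g₁ g₂) , count
    where
    open ≤-Reasoning
    count : countIn Y (S₁ ++ S₂) ≤ 4 * length (ps₁ ++ ps₂) + length (as₁ ++ as₂)
    count = begin
      countIn Y (S₁ ++ S₂)                                               ≡⟨ countIn-++ Y S₁ ⟩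
      countIn Y S₁ + countIn Y S₂                                        ≤⟨ +-mono-≤ c₁ c₂ ⟩
      (4 * length ps₁ + length as₁) + (4 * length ps₂ + length as₂)
        ≡⟨ regroup (length ps₁) (length as₁) (length ps₂) (length as₂) ⟩
      4 * (length ps₁ + length ps₂) + (length as₁ + length as₂)
        ≡⟨ sym (cong₂ (λ k m → 4 * k + m) (length-++ ps₁) (length-++ as₁)) ⟩
      4 * length (ps₁ ++ ps₂) + length (as₁ ++ as₂)                     ∎
      where
      regroup : ∀ k m k′ m′ → (4 * k + m) + (4 * k′ + m′) ≡ 4 * (k + k′) + (m + m′)
      regroup = solve-∀

  record Pivot (v : V) (S : List V) (n : ℕ) : Set where
    constructor pivot
    field
      pathsₚ    : List YP
      stem      : Arm
      others    : List Arm
      validₚ    : Valid (v ∷ S) pathsₚ (stem ∷ others)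
      stemAt    : base stem ≡ v
      othersAdj : All (Adj B v ∘ base) others
      fewer     : length others ≤ n
      countₚ    : countIn Y (v ∷ S) ≤ 4 * length pathsₚ + suc (length others)

  -- Settle a pivot: a lone stem stays an arm; otherwise the stem and another arm form
  -- a new path, which pays for the at most 4 + slack arms it replaces.
  resolve : ∀ {v S n} slack → Pivot v S n → n ≤ 3 + slack → Σ (Packing (v ∷ S) (_≡ v)) (Tally slack)
  resolve slack (pivot ps b [] V at _ _ count) _ =
    packing ps [ b ] V (at ∷ []) , ≤-trans count (+-monoʳ-≤ (4 * length ps) (m≤m⊔n 1 slack))
  resolve slack (pivot ps b (a ∷ as) V at (v-a ∷ _) fewer count) n≤ =
    packing (joinArms a b adj (arms-apart V) ∷ ps) [] (valid-join adj V) [] ,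
    ≤-trans count (pay (length ps) (≤-trans fewer n≤))
    where
    adj : Adj B (base a) (base b)
    adj = subst (Adj B (base a)) (sym at) (adj-sym B v-a)
    pay : ∀ k {m} → m ≤ 3 + slack → 4 * k + suc m ≤ 4 * suc k + slack
    pay k {m} m≤ = ≤-trans (+-monoʳ-≤ (4 * k) (s≤s m≤)) (≤-reflexive (regroup k slack))
      where
      regroup : ∀ k s → 4 * k + (4 + s) ≡ 4 * suc k + s
      regroup = solve-∀

  -- The step at a vertex v ∉ S above the balanced packing of its children's subtrees:
  -- start an arm at v if v ∈ Y, or else prolong one of the children's arms through v.
  -- (Whether v ∈ Y is passed in as a decision, so that countIn Y (v ∷ S) can unfold.)
  close : ∀ {v S} slack → Dec (v ∈ˢ Y) → v ∉ S → (F : Packing S (Adj B v)) → Balanced F →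
          length (arms F) ≤ 3 + slack → Σ (Packing (v ∷ S) (_≡ v)) (Tally slack)
  close {v} {S} slack (yes v∈Y) v∉ (packing ps as V good) count few =
    resolve slack (pivot ps (singleArm v∈Y) as (valid-single v∉ v∈Y V) refl good ≤-refl count′) few
    where
    count′ : countIn Y (v ∷ S) ≤ 4 * length ps + suc (length as)
    count′ = ≤-trans (≤-reflexive (countIn-∈ Y S v∈Y))
               (≤-trans (s≤s count) (≤-reflexive (sym (+-suc (4 * length ps) (length as)))))
  close {v} {S} slack (no v∉Y) v∉ (packing ps [] V []) count few =
    packing ps [] (valid-weaken there V) [] ,
    ≤-trans (≤-reflexive (countIn-∉ Y S v∉Y)) (≤-trans count (+-monoʳ-≤ (4 * length ps) z≤n))
  close {v} {S} slack (no v∉Y) v∉ (packing ps (a ∷ as) V (v-a ∷ good)) count few =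
    resolve slack
      (pivot ps (extendArm a v-a v∉a) as (valid-extend v∉ v-a v∉a V) refl good (n≤1+n _) count′) few
    where
    v∉a : v ∉ trail a
    v∉a = v∉ ∘ All.head (armsInside V)
    count′ : countIn Y (v ∷ S) ≤ 4 * length ps + suc (length as)
    count′ = ≤-trans (≤-reflexive (countIn-∉ Y S v∉Y)) count

  bases-unique : ∀ {as} → AllPairs (λ a b → Disjoint (trail a) (trail b)) as → Unique (map base as)
  bases-unique disj = AllPairs.map⁺ (AllPairs.map (λ d same → d (here refl , here same)) disj)

  armsAtMost : ∀ {v S ps as us} → Valid S ps as → All (Adj B v ∘ base) as →
               Unique us → All (Adj B v) us → Disjoint us S → length us + length as ≤ degree B v
  armsAtMost {v} {S} {as = as} {us} V good uniq adj us-S =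
    subst (_≤ degree B v) (trans (length-++ us) (cong (length us +_) (length-map base as)))
      (distinct-neighbours B
        (Unique.++⁺ uniq (bases-unique (armsDisjoint V)) (λ (u∈us , u∈bases) → us-S (u∈us , inS u∈bases)))
        (All.++⁺ adj (All.map⁺ good)))
    where
    inS : ∀ {u} → u ∈ map base as → u ∈ S
    inS u∈ with _ , a∈ , refl ← ∈-map⁻ base u∈ = All.lookup (armsInside V) a∈ (here refl)

  atMostOneArm : ∀ {r as} → AllPairs (λ a b → Disjoint (trail a) (trail b)) as →
                 All ((_≡ r) ∘ base) as → length as ≤ 1
  atMostOneArm [] [] = z≤n
  atMostOneArm (_ ∷ []) (_ ∷ []) = ≤-refl
  atMostOneArm ((d ∷ _) ∷ _) (at₁ ∷ at₂ ∷ _) = ⊥-elim (d (here refl , here (trans at₁ (sym at₂))))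

module _ (B : Graph) (Y : Subset (nV B)) (deg : MaxDegreeAtMost B 4) where

  private
    V = Fin (nV B)

  belowParent : ∀ {v c S} → Adj B v c → v ∉ S → (F : Packing B Y S (Adj B c)) →
                length (Packing.arms F) ≤ 3
  belowParent e v∉S (packing _ _ V good) =
    ≤-pred (≤-trans (armsAtMost B Y V good ([] ∷ []) (adj-sym B e ∷ []) (λ { (here refl , m) → v∉S m }))
                    (deg _))

  mutual
    forestPacking : ∀ {v} (t : Tree B v) → Unique (vertices B t) →
                    Σ (Packing B Y (below B t) (Adj B v)) (Balanced B Y)
    forestPacking leaf _ = packing [] [] (valid-empty B Y) [] , z≤n
    forestPacking (branch e s t) u
      with us , ut , v∉s , disj ← unique-branch B e s t u
      with P , balP ← subtreePacking e s us v∉s | Q , balQ ← forestPacking t ut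
      = merge B Y disj P balP Q balQ

    -- A subtree s hanging from v at the neighbour c: close the packing of c's children at c.
    -- Since v is a further neighbour of c, at most three of these arms reach c.
    subtreePacking : ∀ {v c} → Adj B v c → (s : Tree B c) → Unique (vertices B s) → v ∉ vertices B s →
                     Σ (Packing B Y (vertices B s) (Adj B v)) (Balanced B Y)
    subtreePacking {v} {c} e s us v∉s
      with F , count ← forestPacking s us
      with packing ps as V at , tally ← close B Y 0 (c ∈ˢ? Y) (Unique.Unique[x∷xs]⇒x∉xs us) F count
                                           (belowParent e (v∉s ∘ there) F)
      = packing ps as V (All.map (λ c≡ → subst (Adj B v) (sym c≡) e) at) ,
        subst (λ m → countIn Y (vertices B s) ≤ 4 * length ps + m) (⊔-identityʳ (length as)) tally

  -- At the root no edge leads to a parent, so up to four arms may arrive; closing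
  -- with slack 1 pays for the extra one.
  rootPacking : ∀ {r} (t : Tree B r) → Unique (vertices B t) →
                Σ (Packing B Y (vertices B t) (_≡ r)) (Tally B Y 1)
  rootPacking {r} t u with F , count ← forestPacking t u =
    close B Y 1 (r ∈ˢ? Y) (Unique.Unique[x∷xs]⇒x∉xs u) F count (atRoot F)
    where
    atRoot : ∀ {S} (F : Packing B Y S (Adj B r)) → length (Packing.arms F) ≤ 4
    atRoot (packing _ _ V good) = ≤-trans (armsAtMost B Y V good [] [] (λ { (() , _) })) (deg r)

  solutionFrom : Connected B → V →
    Σ ℕ λ k → Σ (Fin k → YPath B Y) λ P → PairwiseDisjoint P × (∣ Y ∣ ≤ 4 * k + 1)
  solutionFrom conn r
    with t , u , covers ← treeThrough B conn r (members Y)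
    with packing ps as V at , tally ← rootPacking t u
    = length ps , lookup ps , pairwise , bound
    where
    pairwise : PairwiseDisjoint (lookup ps)
    pairwise i j i≢j v v∈i v∈j = allPairs-lookup disjoint-sym (Valid.pathsDisjoint V) i≢j (v∈i , v∈j)

    open ≤-Reasoning
    bound : ∣ Y ∣ ≤ 4 * length ps + 1
    bound = begin
      ∣ Y ∣                            ≤⟨ card-≤-countIn Y covers ⟩
      countIn Y (vertices B t)         ≤⟨ tally ⟩
      4 * length ps + (length as ⊔ 1)
        ≤⟨ +-monoʳ-≤ (4 * length ps) (⊔-lub (atMostOneArm B Y (Valid.armsDisjoint V) at) ≤-refl) ⟩
      4 * length ps + 1                ∎

lemma4p4 : (B : Graph) → Connected B → MaxDegreeAtMost B 4 →
    (Y : Subset (nV B)) →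
    Σ ℕ λ k → Σ (Fin k → YPath B Y) λ P →
    PairwiseDisjoint P × (∣ Y ∣ ≤ 4 * k + 1)
lemma4p4 B conn deg Y with members Y | members-length Y
... | []    | no-members = 0 , (λ ()) , (λ ()) , subst (_≤ 1) no-members z≤n
... | r ∷ _ | _          = solutionFrom B Y deg conn r
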